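{- Let $s$ be a positive integer and $Q=q^s$. The generating function $\sum_\lambda R^{r_s(\lambda)}C^{c_s(\lambda)}q^{|\lambda|}$, summed over all partitions $\lambda$ (including the empty partition) all of whose parts are divisible by $s$, equals $$1+\sum_{k\ge1}R^k\frac{CQ^k}{(CQ;Q)_k}.$$
   Context: A partition $\lambda$ has size $|\lambda|=\sum\lambda_i$ and is identified with its Ferrers diagram. For a cell $z$, $\mathrm{leg}(z)$ is the number of cells strictly below $z$ in its column and $\mathrm{arm}(z)$ the number of cells strictly to its right in its row. $r_s(\lambda)$ is the number of parts divisible by $s$; $c_s(\lambda)$ is the number of cells $z$ with $\mathrm{leg}(z)=0$ and $s\mid\mathrm{arm}(z)+1$. $(a;Q)_k=\prod_{i=0}^{k-1}(1-aQ^i)$. Identities are of formal power series in $q$ with coefficients polynomials in $R,C$. -}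

module Defs where

open import Level using (Level)
open import Algebra.Bundles using (CommutativeRing)
open import Data.Nat as ℕ using (ℕ; zero; suc; _∸_; _≤?_; _<?_)
open import Data.Nat.Divisibility using (_∣?_)
open import Data.List using (List; []; _∷_; map; concatMap; filter; upTo; length; drop; zip; foldr; zipWith; applyUpTo)
open import Data.Product using (_×_; _,_; proj₁; proj₂)
open import Relation.Nullary.Decidable using (_×-dec_; yes; no)

-- partsF fuel n m : all partitions of n with largest part ≤ m,
-- listed as weakly decreasing lists of positive parts.
-- The fuel argument only ensures structural termination; fuel ≥ n suffices.
partsF : ℕ → ℕ → ℕ → List (List ℕ)
partsF _        zero    m = [] ∷ []
partsF zero     (suc n) m = []
partsF (suc f)  (suc n) m =
  concatMap (λ k → map (suc k ∷_) (partsF f (suc n ∸ suc k) (suc k)))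
            (filter (λ k → suc k ≤? m) (upTo (suc n)))

partitions : ℕ → List (List ℕ)
partitions n = partsF n n n

partitionsDiv : ℕ → ℕ → List (List ℕ)
partitionsDiv s n = filter (Data.List.Relation.Unary.All.all? (s ∣?_)) (partitions n)
  where import Data.List.Relation.Unary.All

rStat : ℕ → List ℕ → ℕ
rStat s λ′ = length (filter (s ∣?_) λ′)

-- cells of the Ferrers diagram: (row i, column j), 0-indexed, j < λ_i
indexed : List ℕ → List (ℕ × ℕ)
indexed λ′ = zip (upTo (length λ′)) λ′

cells : List ℕ → List (ℕ × ℕ)
cells λ′ = concatMap (λ { (i , li) → map (λ j → (i , j)) (upTo li) }) (indexed λ′)

rowLen : List ℕ → ℕ → ℕ
rowLen []       _       = 0
rowLen (x ∷ xs) zero    = x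
rowLen (x ∷ xs) (suc i) = rowLen xs i

arm : List ℕ → ℕ × ℕ → ℕ
arm λ′ (i , j) = rowLen λ′ i ∸ suc j

leg : List ℕ → ℕ × ℕ → ℕ
leg λ′ (i , j) = length (filter (λ l → j <? l) (drop (suc i) λ′))

cStat : ℕ → List ℕ → ℕ
cStat s λ′ = length (filter (λ z → (leg λ′ z ℕ.≟ 0) ×-dec (s ∣? suc (arm λ′ z))) (cells λ′))

module Series {c ℓ : Level} (A : CommutativeRing c ℓ) where
  open CommutativeRing A

  PS : Set c
  PS = ℕ → Carrier

  Σ< : ℕ → (ℕ → Carrier) → Carrier
  Σ< zero    f = 0#
  Σ< (suc n) f = Σ< n f + f n

  pow : Carrier → ℕ → Carrier
  pow x zero    = 1#
  pow x (suc n) = pow x n * x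

  const : Carrier → PS
  const a zero    = a
  const a (suc n) = 0#

  one : PS
  one = const 1#

  qpow : ℕ → PS
  qpow m n with m ℕ.≟ n
  ... | yes _ = 1#
  ... | no  _ = 0#

  _⊕_ : PS → PS → PS
  (f ⊕ g) n = f n + g n

  _⊖_ : PS → PS → PS
  (f ⊖ g) n = f n - g n

  _⊛_ : PS → PS → PS
  (f ⊛ g) n = Σ< (suc n) (λ i → f i * g (n ∸ i))

  scale : Carrier → PS → PS
  scale a f n = a * f n

  _^ˢ_ : PS → ℕ → PS
  f ^ˢ zero  = one
  f ^ˢ suc k = (f ^ˢ k) ⊛ f

  Π< : ℕ → (ℕ → PS) → PS
  Π< zero    f = one
  Π< (suc k) f = Π< k f ⊛ f k

  poch : PS → PS → ℕ → PS
  poch a Q k = Π< k (λ i → one ⊖ (a ⊛ (Q ^ˢ i)))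

  -- Multiplicative inverse of a series with constant term 1:
  -- b_0 = 1, b_n = - Σ_{i=1}^{n} a_i b_{n-i}.
  -- invRev a n = [b_n, b_{n-1}, ..., b_0].
  invRev : PS → ℕ → List Carrier
  invRev a zero    = 1# ∷ []
  invRev a (suc n) =
    (- foldr _+_ 0# (zipWith _*_ (applyUpTo (λ i → a (suc i)) (suc n)) (invRev a n)))
    ∷ invRev a n

  headOr0 : List Carrier → Carrier
  headOr0 []      = 0#
  headOr0 (x ∷ _) = x

  inv : PS → PS
  inv a n = headOr0 (invRev a n)

  -- f / g for g with constant term 1
  _⊘_ : PS → PS → PS
  f ⊘ g = f ⊛ inv g

  -- Sum Σ_{k≥1} T k of a family with T k ∈ q^k ℂ[[q]] (valuation ≥ k):
  -- the coefficient of q^n only receives contributions from k = 1..n.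
  Σ≥1 : (ℕ → PS) → PS
  Σ≥1 T n = Σ< n (λ k → T (suc k) n)

  lhsGF : ℕ → Carrier → Carrier → PS
  lhsGF s R C n =
    foldr _+_ 0# (map (λ λ′ → pow R (rStat s λ′) * pow C (cStat s λ′)) (partitionsDiv s n))

  rhsGF : ℕ → Carrier → Carrier → PS
  rhsGF s R C =
    let Q = qpow s in
    one ⊕ Σ≥1 (λ k → scale (pow R k) ((scale C (Q ^ˢ k)) ⊘ poch (scale C Q) Q k))

{-# OPTIONS --safe #-}
-- Write a partition λ whose parts are all divisible by s as λ = s·μ. Then r_s counts the parts of μ,
-- and c_s = μ₁: in row i the cells with leg 0 are those in columns ≥ λᵢ₊₁, and (λᵢ − λᵢ₊₁)/s
-- of them have s ∣ arm + 1, which telescopes to λ₁/s. So the left side is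
-- Σ_μ R^ℓ(μ) C^μ₁ Q^|μ|. Let E_k collect the μ with exactly k parts and A_k = E_0 + ⋯ + E_k.
-- Deleting the first column of a μ with k parts leaves one with at most k parts, so
-- E_k = C Q^k A_k; hence (1 − C Q^k) A_k = A_{k−1} and A_0 = 1, so A_k = 1/(CQ;Q)_k and
-- E_k = C Q^k/(CQ;Q)_k.
module Submission where

open import Defs
open import Level using (Level)
open import Algebra.Bundles using (CommutativeRing)
open import Data.Nat using (ℕ; _<_)

open import Data.Bool using (if_then_else_; _∧_)
open import Data.List using (List; []; _∷_; _++_; foldr; map; filter; concatMap; zipWith; applyUpTo; upTo; length)
import Data.List.Properties as List
open import Data.List.Relation.Unary.All as All using (All; []; _∷_; all?)
open import Data.List.Relation.Unary.Linked as Linked using (Linked)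
open import Data.Nat using (zero; suc; _≤_; _≥_; _∸_; z≤n; s≤s; s≤s⁻¹; _≤?_; NonZero)
import Data.Nat as ℕ
import Data.Nat.Properties as ℕₚ
open import Data.Nat.DivMod using (_/_; 0/n≡0; m*n/n≡m)
open import Data.Nat.Divisibility using (_∣_; _∣?_; ∣-refl; ∣⇒≤; ∣m+n∣m⇒∣n; ∣m∣n⇒∣m+n; n∣m*n)
open import Data.Nat.Induction using (<-rec)
open import Function using (_∘_; id)
open import Relation.Binary.Bundles using (Setoid)
open import Relation.Binary.PropositionalEquality as ≡ using (_≡_; _≢_)
open import Relation.Nullary using (Dec; yes; no; does; contradiction; ¬_)
open import Relation.Unary using (Pred; Decidable)

0<[1+k]*s : ∀ k s .{{_ : NonZero s}} → 0 < suc k ℕ.* s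
0<[1+k]*s k s = ℕₚ.<-≤-trans (s≤s z≤n) (ℕₚ.m≤m*n (suc k) s)

module PartitionCombinatorics where
  open import Data.Nat
  open import Data.Nat.Properties
  open import Data.Nat.DivMod using (m≡m%n+[m/n]*n; m%n<n; +-distrib-/-∣ʳ)
  open import Data.Nat.Divisibility using (_∣0)
  open import Data.Bool using (true; false)
  open import Data.List using ([_]; zip)
  import Data.List.Relation.Unary.All.Properties as Allₚ
  open import Data.List.Relation.Unary.Linked using ([-]; _∷_)
  open import Data.List.Relation.Unary.Linked.Properties using (Linked⇒All)
  open import Data.Product as Product using (_×_; _,_; proj₂; map₁)
  open import Function using (_⇔_; mk⇔; Equivalence)
  open import Relation.Binary.PropositionalEquality using (refl; sym; trans; cong; cong₂; subst; module ≡-Reasoning)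
  open import Relation.Nullary.Decidable using (_×-dec_)

  count-++ : ∀ {a p} {A : Set a} {P : Pred A p} (P? : Decidable P) xs ys →
             length (filter P? (xs ++ ys)) ≡ length (filter P? xs) + length (filter P? ys)
  count-++ P? xs ys = trans (cong length (List.filter-++ P? xs ys)) (List.length-++ (filter P? xs))

  count-map : ∀ {a b p} {A : Set a} {B : Set b} {P : Pred A p} (P? : Decidable P) (g : B → A) xs →
              length (filter P? (map g xs)) ≡ length (filter (P? ∘ g) xs)
  count-map P? g []       = refl
  count-map P? g (x ∷ xs) with does (P? (g x))
  ... | true  = cong suc (count-map P? g xs)
  ... | false = count-map P? g xs

  count-cong : ∀ {a p q} {A : Set a} {P : Pred A p} {Q : Pred A q} (P? : Decidable P) (Q? : Decidable Q) {xs} →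
               All (λ x → P x ⇔ Q x) xs → length (filter P? xs) ≡ length (filter Q? xs)
  count-cong P? Q? []                   = refl
  count-cong P? Q? {x ∷ _} (P⇔Q ∷ P⇔Qs) with P? x | Q? x
  ... | yes _  | yes _  = cong suc (count-cong P? Q? P⇔Qs)
  ... | no _   | no _   = count-cong P? Q? P⇔Qs
  ... | yes Px | no ¬Qx = contradiction (Equivalence.to P⇔Q Px) ¬Qx
  ... | no ¬Px | yes Qx = contradiction (Equivalence.from P⇔Q Qx) ¬Px

  count-upTo-suc : ∀ {p} {P : Pred ℕ p} (P? : Decidable P) n →
    length (filter P? (upTo (suc n))) ≡ length (filter P? [ 0 ]) + length (filter (P? ∘ suc) (upTo n))
  count-upTo-suc P? n = trans (count-++ P? [ 0 ] (applyUpTo suc n))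
    (cong (length (filter P? [ 0 ]) +_)
          (trans (cong (length ∘ filter P?) (sym (List.map-upTo suc n))) (count-map P? suc (upTo n))))

  count-singleton-accept : ∀ {a p} {A : Set a} {P : Pred A p} (P? : Decidable P) {x} →
                           P x → length (filter P? [ x ]) ≡ 1
  count-singleton-accept P? Px = cong length (List.filter-accept P? Px)

  count-singleton-reject : ∀ {a p} {A : Set a} {P : Pred A p} (P? : Decidable P) {x} →
                           ¬ P x → length (filter P? [ x ]) ≡ 0
  count-singleton-reject P? ¬Px = cong length (List.filter-reject P? ¬Px)

  cells-cons : ∀ x xs → cells (x ∷ xs) ≡ map (0 ,_) (upTo x) ++ map (map₁ suc) (cells xs)
  cells-cons x xs = cong (map (0 ,_) (upTo x) ++_) (shiftRows id (length xs) xs)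
    where
    row : ℕ × ℕ → List (ℕ × ℕ)
    row (i , l) = map (i ,_) (upTo l)
    shiftRows : ∀ (f : ℕ → ℕ) n ys →
      concatMap row (zip (applyUpTo (suc ∘ f) n) ys) ≡ map (map₁ suc) (concatMap row (zip (applyUpTo f n) ys))
    shiftRows f zero    ys       = refl
    shiftRows f (suc n) []       = refl
    shiftRows f (suc n) (y ∷ ys) =
      trans (cong₂ _++_ (List.map-∘ (upTo y)) (shiftRows (f ∘ suc) n ys))
            (sym (List.map-++ (map₁ suc) (row (f 0 , y)) _))

  largestPart : List ℕ → ℕ
  largestPart []      = 0
  largestPart (x ∷ _) = x

  noneAbove⇔largestPart≤ : ∀ {xs} j → Linked _≥_ xs → length (filter (j <?_) xs) ≡ 0 ⇔ largestPart xs ≤ j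
  noneAbove⇔largestPart≤ {[]}     j _    = mk⇔ (λ _ → z≤n) (λ _ → refl)
  noneAbove⇔largestPart≤ {x ∷ xs} j decr = mk⇔ to from
    where
    to : length (filter (j <?_) (x ∷ xs)) ≡ 0 → x ≤ j
    to none with j <? x
    ... | yes j<x = contradiction (trans (cong length (sym (List.filter-accept (j <?_) j<x))) none) λ ()
    ... | no  j≮x = ≮⇒≥ j≮x
    from : x ≤ j → length (filter (j <?_) (x ∷ xs)) ≡ 0
    from x≤j = cong length (List.filter-none (j <?_)
                 (All.map (λ y≤x → ≤⇒≯ (≤-trans y≤x x≤j))
                          (Linked⇒All (λ i≥j j≥k → ≤-trans j≥k i≥j) ≤-refl decr)))

  largestPart-≤ : ∀ {x xs} → Linked _≥_ (x ∷ xs) → largestPart xs ≤ x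
  largestPart-≤ [-]       = z≤n
  largestPart-≤ (x≥y ∷ _) = x≥y

  largestPart-∣ : ∀ {d xs} → All (d ∣_) xs → d ∣ largestPart xs
  largestPart-∣ {d} []        = d ∣0
  largestPart-∣     (d∣x ∷ _) = d∣x

  multiplesUpTo : ℕ → ℕ → ℕ
  multiplesUpTo s d = length (filter (λ i → s ∣? d ∸ i) (upTo d))

  module _ (s : ℕ) .{{_ : NonZero s}} where
    open ≡-Reasoning

    multiplesUpTo-suc : ∀ d → multiplesUpTo s (suc d) ≡ length (filter (s ∣?_) [ suc d ]) + multiplesUpTo s d
    multiplesUpTo-suc d = trans (count-upTo-suc (λ i → s ∣? suc d ∸ i) d)
                                (cong (_+ multiplesUpTo s d) (sym (count-map (s ∣?_) (suc d ∸_) [ 0 ])))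

    multiplesUpTo-< : ∀ {d} → d < s → multiplesUpTo s d ≡ 0
    multiplesUpTo-< {zero}  _   = refl
    multiplesUpTo-< {suc d} d<s = begin
      multiplesUpTo s (suc d)                                   ≡⟨ multiplesUpTo-suc d ⟩
      length (filter (s ∣?_) [ suc d ]) + multiplesUpTo s d    ≡⟨ cong₂ _+_ (count-singleton-reject (s ∣?_) (<⇒≱ d<s ∘ ∣⇒≤))
                                                                              (multiplesUpTo-< (<-trans (n<1+n d) d<s)) ⟩
      0                                                         ∎

    multiplesUpTo-self : multiplesUpTo s s ≡ 1
    multiplesUpTo-self = begin
      multiplesUpTo s s                                             ≡⟨ cong (multiplesUpTo s) (sym (suc-pred s)) ⟩
      multiplesUpTo s (suc p)                                       ≡⟨ multiplesUpTo-suc p ⟩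
      length (filter (s ∣?_) [ suc p ]) + multiplesUpTo s p        ≡⟨ cong₂ _+_ (count-singleton-accept (s ∣?_) s∣p+1)
                                                                                  (multiplesUpTo-< (≤-reflexive (suc-pred s))) ⟩
      1                                                             ∎
      where
      p = pred s
      s∣p+1 : s ∣ suc p
      s∣p+1 = subst (s ∣_) (sym (suc-pred s)) ∣-refl

    multiplesUpTo-+s : ∀ d → multiplesUpTo s (d + s) ≡ suc (multiplesUpTo s d)
    multiplesUpTo-+s zero    = multiplesUpTo-self
    multiplesUpTo-+s (suc d) = begin
      multiplesUpTo s (suc (d + s))                                       ≡⟨ multiplesUpTo-suc (d + s) ⟩
      length (filter (s ∣?_) [ suc d + s ]) + multiplesUpTo s (d + s)    ≡⟨ cong₂ _+_ sameDivisibility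
                                                                                        (multiplesUpTo-+s d) ⟩
      length (filter (s ∣?_) [ suc d ]) + suc (multiplesUpTo s d)        ≡⟨ +-suc _ _ ⟩
      suc (length (filter (s ∣?_) [ suc d ]) + multiplesUpTo s d)        ≡⟨ cong suc (multiplesUpTo-suc d) ⟨
      suc (multiplesUpTo s (suc d))                                       ∎
      where
      sameDivisibility : length (filter (s ∣?_) [ suc d + s ]) ≡ length (filter (s ∣?_) [ suc d ])
      sameDivisibility with s ∣? suc d
      ... | yes s∣d+1 = count-singleton-accept (s ∣?_) (∣m∣n⇒∣m+n s∣d+1 ∣-refl)
      ... | no  s∤d+1 = count-singleton-reject (s ∣?_)
                          (λ s∣d+1+s → s∤d+1 (∣m+n∣m⇒∣n (subst (s ∣_) (+-comm (suc d) s) s∣d+1+s) ∣-refl))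

    multiplesUpTo-+* : ∀ d e → multiplesUpTo s (d + e * s) ≡ multiplesUpTo s d + e
    multiplesUpTo-+* d zero    = trans (cong (multiplesUpTo s) (+-identityʳ d)) (sym (+-identityʳ _))
    multiplesUpTo-+* d (suc e) = begin
      multiplesUpTo s (d + (s + e * s))   ≡⟨ cong (multiplesUpTo s) (sym (+-assoc d s (e * s))) ⟩
      multiplesUpTo s (d + s + e * s)     ≡⟨ multiplesUpTo-+* (d + s) e ⟩
      multiplesUpTo s (d + s) + e         ≡⟨ cong (_+ e) (multiplesUpTo-+s d) ⟩
      suc (multiplesUpTo s d) + e         ≡⟨ +-suc _ e ⟨
      multiplesUpTo s d + suc e           ∎

    multiplesUpTo≡/ : ∀ d → multiplesUpTo s d ≡ d / s
    multiplesUpTo≡/ d = begin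
      multiplesUpTo s d                       ≡⟨ cong (multiplesUpTo s) (m≡m%n+[m/n]*n d s) ⟩
      multiplesUpTo s (d % s + (d / s) * s)   ≡⟨ multiplesUpTo-+* (d % s) (d / s) ⟩
      multiplesUpTo s (d % s) + d / s         ≡⟨ cong (_+ d / s) (multiplesUpTo-< (m%n<n d s)) ⟩
      d / s                                   ∎

    cornersInRow : ℕ → ℕ → ℕ
    cornersInRow h x = length (filter (λ j → (h ≤? j) ×-dec (s ∣? x ∸ j)) (upTo x))

    cornersInRow-+ : ∀ h d → cornersInRow h (h + d) ≡ multiplesUpTo s d
    cornersInRow-+ zero    d = cong length (List.filter-≐ _ (λ i → s ∣? d ∸ i) (proj₂ , (z≤n ,_)) (upTo d))
    cornersInRow-+ (suc h) d = trans (count-upTo-suc (λ j → (suc h ≤? j) ×-dec (s ∣? suc (h + d) ∸ j)) (h + d))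
      (trans (cong length (List.filter-≐ _ (λ j → (h ≤? j) ×-dec (s ∣? h + d ∸ j))
                                          (Product.map₁ s≤s⁻¹ , Product.map₁ s≤s) (upTo (h + d))))
             (cornersInRow-+ h d))

    cornersInRow≡/ : ∀ {h x} → h ≤ x → cornersInRow h x ≡ (x ∸ h) / s
    cornersInRow≡/ {h} {x} h≤x = begin
      cornersInRow h x               ≡⟨ cong (cornersInRow h) (m+[n∸m]≡n h≤x) ⟨
      cornersInRow h (h + (x ∸ h))   ≡⟨ cornersInRow-+ h (x ∸ h) ⟩
      multiplesUpTo s (x ∸ h)        ≡⟨ multiplesUpTo≡/ (x ∸ h) ⟩
      (x ∸ h) / s                    ∎

    corner? : (λ′ : List ℕ) → Decidable (λ z → leg λ′ z ≡ 0 × s ∣ suc (arm λ′ z))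
    corner? λ′ z = (leg λ′ z ≟ 0) ×-dec (s ∣? suc (arm λ′ z))

    topRowCorners : ℕ → List ℕ → ℕ
    topRowCorners x xs = length (filter (λ j → corner? (x ∷ xs) (0 , j)) (upTo x))

    cStat-∷ : ∀ x xs → cStat s (x ∷ xs) ≡ topRowCorners x xs + cStat s xs
    cStat-∷ x xs = begin
      cStat s (x ∷ xs)
        ≡⟨ cong (length ∘ filter (corner? (x ∷ xs))) (cells-cons x xs) ⟩
      length (filter (corner? (x ∷ xs)) (map (0 ,_) (upTo x) ++ map (map₁ suc) (cells xs)))
        ≡⟨ count-++ (corner? (x ∷ xs)) (map (0 ,_) (upTo x)) (map (map₁ suc) (cells xs)) ⟩
      length (filter (corner? (x ∷ xs)) (map (0 ,_) (upTo x))) + length (filter (corner? (x ∷ xs)) (map (map₁ suc) (cells xs)))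
        ≡⟨ cong₂ _+_ (count-map (corner? (x ∷ xs)) (0 ,_) (upTo x)) (count-map (corner? (x ∷ xs)) (map₁ suc) (cells xs)) ⟩
      topRowCorners x xs + cStat s xs
        ∎

    topRowCorners≡cornersInRow : ∀ {x xs} → Linked _≥_ (x ∷ xs) →
                                 topRowCorners x xs ≡ cornersInRow (largestPart xs) x
    topRowCorners≡cornersInRow {x} {xs} decr =
      count-cong _ _ (Allₚ.applyUpTo⁺₁ id x cornerAt⇔)
      where
      cornerAt⇔ : ∀ {j} → j < x →
        (leg (x ∷ xs) (0 , j) ≡ 0 × s ∣ suc (arm (x ∷ xs) (0 , j))) ⇔ (largestPart xs ≤ j × s ∣ x ∸ j)
      cornerAt⇔ {j} j<x = mk⇔ (Product.map (Equivalence.to below) (subst (s ∣_) (sym armLength)))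
                              (Product.map (Equivalence.from below) (subst (s ∣_) armLength))
        where
        below = noneAbove⇔largestPart≤ j (Linked.tail decr)
        armLength : x ∸ j ≡ suc (x ∸ suc j)
        armLength = +-∸-assoc 1 j<x

    cStat-decreasing : ∀ {λ′} → Linked _≥_ λ′ → All (s ∣_) λ′ → cStat s λ′ ≡ largestPart λ′ / s
    cStat-decreasing {[]}     _    _              = sym (0/n≡0 s)
    cStat-decreasing {x ∷ xs} decr (s∣x ∷ s∣xs) = begin
      cStat s (x ∷ xs)                 ≡⟨ cStat-∷ x xs ⟩
      topRowCorners x xs + cStat s xs  ≡⟨ cong₂ _+_ (trans (topRowCorners≡cornersInRow decr) (cornersInRow≡/ h≤x))
                                                     (cStat-decreasing (Linked.tail decr) s∣xs) ⟩
      (x ∸ h) / s + h / s              ≡⟨ +-distrib-/-∣ʳ (x ∸ h) (largestPart-∣ s∣xs) ⟨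
      (x ∸ h + h) / s                  ≡⟨ cong (_/ s) (m∸n+n≡m h≤x) ⟩
      x / s                            ∎
      where
      h = largestPart xs
      h≤x = largestPart-≤ decr

  partsF-bound : ∀ f n {m} → n ≤ m → partsF f n m ≡ partsF f n n
  partsF-bound f       zero    _   = refl
  partsF-bound zero    (suc n) _   = refl
  partsF-bound (suc f) (suc n) {m} n≤m = cong (concatMap (λ k → map (suc k ∷_) (partsF f (suc n ∸ suc k) (suc k))))
    (trans (List.filter-all (λ k → suc k ≤? m) (Allₚ.applyUpTo⁺₁ id (suc n) (λ k<n → ≤-trans k<n n≤m)))
           (sym (List.filter-all (λ k → suc k ≤? suc n) (Allₚ.applyUpTo⁺₁ id (suc n) id))))

  partsF-decreasing : ∀ f n m → All (λ λ′ → Linked _≥_ (m ∷ λ′)) (partsF f n m)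
  partsF-decreasing f       zero    m = [-] ∷ []
  partsF-decreasing zero    (suc n) m = []
  partsF-decreasing (suc f) (suc n) m = Allₚ.concat⁺ (Allₚ.map⁺ (All.map
    (λ {k} k<m → Allₚ.map⁺ (All.map (k<m ∷_) (partsF-decreasing f (suc n ∸ suc k) (suc k))))
    (Allₚ.all-filter (λ k → suc k ≤? m) (upTo (suc n)))))

module FiniteSums {c ℓ : Level} (A : CommutativeRing c ℓ) where
  open CommutativeRing A
  open Series A
  open import Algebra.Properties.Ring ring using (-1*x≈-x)
  import Relation.Binary.Reasoning.Setoid
  module ≈-Reasoning = Relation.Binary.Reasoning.Setoid setoid

  Σ-congᵇ : ∀ n {f g : ℕ → Carrier} → (∀ i → i < n → f i ≈ g i) → Σ< n f ≈ Σ< n g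
  Σ-congᵇ zero    f≈g = refl
  Σ-congᵇ (suc n) f≈g = +-cong (Σ-congᵇ n (λ i i<n → f≈g i (ℕₚ.m<n⇒m<1+n i<n))) (f≈g n ℕₚ.≤-refl)

  Σ-cong : ∀ n {f g : ℕ → Carrier} → (∀ i → f i ≈ g i) → Σ< n f ≈ Σ< n g
  Σ-cong n f≈g = Σ-congᵇ n (λ i _ → f≈g i)

  Σ-zero : ∀ n {f : ℕ → Carrier} → (∀ i → f i ≈ 0#) → Σ< n f ≈ 0#
  Σ-zero zero    f≈0 = refl
  Σ-zero (suc n) f≈0 = trans (+-cong (Σ-zero n f≈0) (f≈0 n)) (+-identityʳ 0#)

  Σ-distrib-+ : ∀ n (f g : ℕ → Carrier) → Σ< n (λ i → f i + g i) ≈ Σ< n f + Σ< n g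
  Σ-distrib-+ zero    f g = sym (+-identityʳ 0#)
  Σ-distrib-+ (suc n) f g = trans (+-congʳ (Σ-distrib-+ n f g)) (+-interchange _ _ _ _)
    where open import Algebra.Properties.CommutativeSemigroup +-commutativeSemigroup
            using () renaming (interchange to +-interchange)

  Σ-*ˡ : ∀ n a (f : ℕ → Carrier) → a * Σ< n f ≈ Σ< n (λ i → a * f i)
  Σ-*ˡ zero    a f = zeroʳ a
  Σ-*ˡ (suc n) a f = trans (distribˡ a _ _) (+-congʳ (Σ-*ˡ n a f))

  Σ-neg : ∀ n (f : ℕ → Carrier) → - Σ< n f ≈ Σ< n (λ i → - f i)
  Σ-neg n f = begin
    - Σ< n f                  ≈⟨ -1*x≈-x _ ⟨
    - 1# * Σ< n f             ≈⟨ Σ-*ˡ n (- 1#) f ⟩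
    Σ< n (λ i → - 1# * f i)   ≈⟨ Σ-cong n (λ i → -1*x≈-x (f i)) ⟩
    Σ< n (λ i → - f i)        ∎
    where open ≈-Reasoning

  Σ-distrib-- : ∀ n (f g : ℕ → Carrier) → Σ< n (λ i → f i - g i) ≈ Σ< n f - Σ< n g
  Σ-distrib-- n f g = trans (Σ-distrib-+ n f (λ i → - g i)) (+-congˡ (sym (Σ-neg n g)))

  Σ-front : ∀ n (f : ℕ → Carrier) → Σ< (suc n) f ≈ f 0 + Σ< n (λ i → f (suc i))
  Σ-front zero    f = trans (+-identityˡ _) (sym (+-identityʳ _))
  Σ-front (suc n) f = trans (+-congʳ (Σ-front n f)) (+-assoc _ _ _)

  Σ-split : ∀ m n (f : ℕ → Carrier) → Σ< (m ℕ.+ n) f ≈ Σ< m f + Σ< n (λ j → f (m ℕ.+ j))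
  Σ-split m zero    f rewrite ℕₚ.+-identityʳ m = sym (+-identityʳ _)
  Σ-split m (suc n) f rewrite ℕₚ.+-suc m n = trans (+-congʳ (Σ-split m n f)) (+-assoc _ _ _)

  Σ-reverse : ∀ n (f : ℕ → Carrier) → Σ< (suc n) f ≈ Σ< (suc n) (λ i → f (n ∸ i))
  Σ-reverse zero    f = refl
  Σ-reverse (suc n) f = begin
    Σ< (suc n) f + f (suc n)                  ≈⟨ +-congʳ (Σ-reverse n f) ⟩
    Σ< (suc n) (λ i → f (n ∸ i)) + f (suc n)  ≈⟨ +-comm _ _ ⟩
    f (suc n) + Σ< (suc n) (λ i → f (n ∸ i))  ≈⟨ Σ-front (suc n) (λ i → f (suc n ∸ i)) ⟨
    Σ< (suc (suc n)) (λ i → f (suc n ∸ i))    ∎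
    where open ≈-Reasoning

  Σ-swap : ∀ m n (f : ℕ → ℕ → Carrier) →
           Σ< m (λ i → Σ< n (f i)) ≈ Σ< n (λ j → Σ< m (λ i → f i j))
  Σ-swap zero    n f = sym (Σ-zero n (λ _ → refl))
  Σ-swap (suc m) n f = trans (+-congʳ (Σ-swap m n f)) (sym (Σ-distrib-+ n _ _))

  Σ-last : ∀ n .{{_ : NonZero n}} (f : ℕ → Carrier) → Σ< n f ≈ Σ< (ℕ.pred n) f + f (ℕ.pred n)
  Σ-last (suc n) f = refl

  when : ∀ {p} {P : Set p} → Dec P → Carrier → Carrier
  when d x = if does d then x else 0#

  when-cong : ∀ {p} {P : Set p} (d : Dec P) {x y} → (P → x ≈ y) → when d x ≈ when d y
  when-cong (yes p) x≈y = x≈y p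
  when-cong (no  _) x≈y = refl

  when-⇔ : ∀ {p q} {P : Set p} {Q : Set q} (d : Dec P) (e : Dec Q) {x} → (P → Q) → (Q → P) → when d x ≈ when e x
  when-⇔ (yes _) (yes _) P→Q Q→P = refl
  when-⇔ (no  _) (no  _) P→Q Q→P = refl
  when-⇔ (yes p) (no ¬q) P→Q Q→P = contradiction (P→Q p) ¬q
  when-⇔ (no ¬p) (yes q) P→Q Q→P = contradiction (Q→P q) ¬p

  when-yes : ∀ {p} {P : Set p} (d : Dec P) {x} → P → when d x ≈ x
  when-yes (yes _) _ = refl
  when-yes (no ¬p) p = contradiction p ¬p

  when-no : ∀ {p} {P : Set p} (d : Dec P) {x} → ¬ P → when d x ≈ 0#
  when-no (yes p) ¬p = contradiction p ¬p
  when-no (no  _) _  = refl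

  when-*ʳ : ∀ {p} {P : Set p} (d : Dec P) x y → when d x * y ≈ when d (x * y)
  when-*ʳ (yes _) x y = refl
  when-*ʳ (no  _) x y = zeroˡ y

  when-comm : ∀ {p q} {P : Set p} {Q : Set q} (d : Dec P) (e : Dec Q) x → when d (when e x) ≈ when e (when d x)
  when-comm (yes _) e x = refl
  when-comm (no  _) (yes _) x = refl
  when-comm (no  _) (no  _) x = refl

  Σ-when-< : ∀ N L (f : ℕ → Carrier) → Σ< N (λ p → when (suc p ≤? L) (f p)) ≈ Σ< (N ℕ.⊓ L) f
  Σ-when-< zero    L f = refl
  Σ-when-< (suc N) L f with N ℕ.<? L
  ... | yes N<L = begin
    Σ< N (λ p → when (suc p ≤? L) (f p)) + when (suc N ≤? L) (f N)
      ≈⟨ +-cong (Σ-when-< N L f) (when-yes (suc N ≤? L) N<L) ⟩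
    Σ< (N ℕ.⊓ L) f + f N
      ≡⟨ ≡.cong (λ m → Σ< m f + f N) (ℕₚ.m≤n⇒m⊓n≡m (ℕₚ.<⇒≤ N<L)) ⟩
    Σ< (suc N) f
      ≡⟨ ≡.cong (λ m → Σ< m f) (ℕₚ.m≤n⇒m⊓n≡m N<L) ⟨
    Σ< (suc N ℕ.⊓ L) f
      ∎
    where open ≈-Reasoning
  ... | no  N≮L = begin
    Σ< N (λ p → when (suc p ≤? L) (f p)) + when (suc N ≤? L) (f N)
      ≈⟨ +-cong (Σ-when-< N L f) (when-no (suc N ≤? L) N≮L) ⟩
    Σ< (N ℕ.⊓ L) f + 0#
      ≈⟨ +-identityʳ _ ⟩
    Σ< (N ℕ.⊓ L) f
      ≡⟨ ≡.cong (λ m → Σ< m f) (ℕₚ.m≥n⇒m⊓n≡n L≤N) ⟩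
    Σ< L f
      ≡⟨ ≡.cong (λ m → Σ< m f) (ℕₚ.m≥n⇒m⊓n≡n (ℕₚ.m≤n⇒m≤1+n L≤N)) ⟨
    Σ< (suc N ℕ.⊓ L) f
      ∎
    where
    open ≈-Reasoning
    L≤N = ℕₚ.≮⇒≥ N≮L

  Σ-when-<-swap : ∀ N L (f : ℕ → Carrier) →
                  Σ< N (λ p → when (suc p ≤? L) (f p)) ≈ Σ< L (λ p → when (suc p ≤? N) (f p))
  Σ-when-<-swap N L f = begin
    Σ< N (λ p → when (suc p ≤? L) (f p)) ≈⟨ Σ-when-< N L f ⟩
    Σ< (N ℕ.⊓ L) f                       ≡⟨ ≡.cong (λ m → Σ< m f) (ℕₚ.⊓-comm N L) ⟩
    Σ< (L ℕ.⊓ N) f                       ≈⟨ Σ-when-< L N f ⟨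
    Σ< L (λ p → when (suc p ≤? N) (f p)) ∎
    where open ≈-Reasoning

  sumL : ∀ {a} {I : Set a} → (I → Carrier) → List I → Carrier
  sumL f xs = foldr _+_ 0# (map f xs)

  sumL-congᴬ : ∀ {a p} {I : Set a} {P : Pred I p} {f g : I → Carrier} {xs} →
               (∀ {x} → P x → f x ≈ g x) → All P xs → sumL f xs ≈ sumL g xs
  sumL-congᴬ f≈g []         = refl
  sumL-congᴬ f≈g (px ∷ pxs) = +-cong (f≈g px) (sumL-congᴬ f≈g pxs)

  sumL-cong : ∀ {a} {I : Set a} {f g : I → Carrier} → (∀ x → f x ≈ g x) → ∀ xs → sumL f xs ≈ sumL g xs
  sumL-cong f≈g []       = refl
  sumL-cong f≈g (x ∷ xs) = +-cong (f≈g x) (sumL-cong f≈g xs)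

  sumL-++ : ∀ {a} {I : Set a} (f : I → Carrier) xs ys → sumL f (xs ++ ys) ≈ sumL f xs + sumL f ys
  sumL-++ f []       ys = sym (+-identityˡ _)
  sumL-++ f (x ∷ xs) ys = trans (+-congˡ (sumL-++ f xs ys)) (sym (+-assoc _ _ _))

  sumL-concatMap : ∀ {a b} {I : Set a} {J : Set b} (f : J → Carrier) (h : I → List J) xs →
                   sumL f (concatMap h xs) ≈ sumL (sumL f ∘ h) xs
  sumL-concatMap f h []       = refl
  sumL-concatMap f h (x ∷ xs) = trans (sumL-++ f (h x) (concatMap h xs)) (+-congˡ (sumL-concatMap f h xs))

  sumL-map : ∀ {a b} {I : Set a} {J : Set b} (f : J → Carrier) (g : I → J) xs → sumL f (map g xs) ≡ sumL (f ∘ g) xs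
  sumL-map f g xs = ≡.cong (foldr _+_ 0#) (≡.sym (List.map-∘ xs))

  sumL-filter : ∀ {a p} {I : Set a} {P : Pred I p} (P? : Decidable P) (f : I → Carrier) xs →
                sumL f (filter P? xs) ≈ sumL (λ x → when (P? x) (f x)) xs
  sumL-filter P? f []       = refl
  sumL-filter P? f (x ∷ xs) with P? x
  ... | yes _ = +-congˡ (sumL-filter P? f xs)
  ... | no  _ = trans (sumL-filter P? f xs) (sym (+-identityˡ _))

  sumL-applyUpTo : ∀ {a} {I : Set a} (f : I → Carrier) (g : ℕ → I) n → sumL f (applyUpTo g n) ≈ Σ< n (f ∘ g)
  sumL-applyUpTo f g zero    = refl
  sumL-applyUpTo f g (suc n) = trans (+-congˡ (sumL-applyUpTo f (g ∘ suc) n)) (sym (Σ-front n (f ∘ g)))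

  sumL-*ˡ : ∀ {a} {I : Set a} c (f : I → Carrier) xs → c * sumL f xs ≈ sumL (λ x → c * f x) xs
  sumL-*ˡ c f []       = zeroʳ c
  sumL-*ˡ c f (x ∷ xs) = trans (distribˡ c _ _) (+-congˡ (sumL-*ˡ c f xs))

module FormalPowerSeries {c ℓ : Level} (A : CommutativeRing c ℓ) where
  open CommutativeRing A
  open Series A
  open FiniteSums A
  open import Algebra.Properties.Ring ring using (+-cancelˡ; [y-z]x≈yx-zx)
  import Relation.Binary.Reasoning.Setoid

  infix 4 _≐_
  _≐_ : PS → PS → Set ℓ
  X ≐ Y = ∀ n → X n ≈ Y n

  ≐-setoid : Setoid c ℓ
  ≐-setoid = record
    { Carrier       = PS
    ; _≈_           = _≐_
    ; isEquivalence = record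
      { refl  = λ _ → refl
      ; sym   = λ X≐Y n → sym (X≐Y n)
      ; trans = λ X≐Y Y≐Z n → trans (X≐Y n) (Y≐Z n)
      }
    }

  open Setoid ≐-setoid public using () renaming (refl to ≐-refl; sym to ≐-sym; trans to ≐-trans)

  module ≐-Reasoning = Relation.Binary.Reasoning.Setoid ≐-setoid

  Σˢ : ℕ → (ℕ → PS) → PS
  Σˢ m F n = Σ< m (λ i → F i n)

  shift : ℕ → PS → PS
  shift zero    X n       = X n
  shift (suc m) X zero    = 0#
  shift (suc m) X (suc n) = shift m X n

  shift-congᵇ : ∀ m n {X Y} → (∀ j → j ℕ.+ m ≤ n → X j ≈ Y j) → shift m X n ≈ shift m Y n
  shift-congᵇ zero    n       X≈Y = X≈Y n (ℕₚ.≤-reflexive (ℕₚ.+-identityʳ n))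
  shift-congᵇ (suc m) zero    X≈Y = refl
  shift-congᵇ (suc m) (suc n) X≈Y =
    shift-congᵇ m n (λ j j+m≤n → X≈Y j (≡.subst (_≤ suc n) (≡.sym (ℕₚ.+-suc j m)) (s≤s j+m≤n)))

  shift-cong : ∀ m {X Y} → X ≐ Y → shift m X ≐ shift m Y
  shift-cong m X≐Y n = shift-congᵇ m n (λ j _ → X≐Y j)

  shift-below : ∀ {m n} X → n < m → shift m X n ≈ 0#
  shift-below {suc m} {zero}  X _         = refl
  shift-below {suc m} {suc n} X (s≤s n<m) = shift-below X n<m

  shift-when : ∀ m n X → shift m X n ≈ when (m ≤? n) (X (n ∸ m))
  shift-when zero    n       X = refl
  shift-when (suc m) zero    X = refl
  shift-when (suc m) (suc n) X = trans (shift-when m n X) (when-⇔ (m ≤? n) (suc m ≤? suc n) s≤s s≤s⁻¹)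

  shift-+ : ∀ m n X → shift m (shift n X) ≐ shift (m ℕ.+ n) X
  shift-+ zero    n X k       = refl
  shift-+ (suc m) n X zero    = refl
  shift-+ (suc m) n X (suc k) = shift-+ m n X k

  shift-scale : ∀ m a X → shift m (scale a X) ≐ scale a (shift m X)
  shift-scale zero    a X k       = refl
  shift-scale (suc m) a X zero    = sym (zeroʳ a)
  shift-scale (suc m) a X (suc k) = shift-scale m a X k

  shift-Σˢ : ∀ m N F → shift m (Σˢ N F) ≐ Σˢ N (λ i → shift m (F i))
  shift-Σˢ zero    N F k       = refl
  shift-Σˢ (suc m) N F zero    = sym (Σ-zero N (λ _ → refl))
  shift-Σˢ (suc m) N F (suc k) = shift-Σˢ m N F k

  ⊛-cong : ∀ {X X′ Y Y′} → X ≐ X′ → Y ≐ Y′ → X ⊛ Y ≐ X′ ⊛ Y′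
  ⊛-cong X≐X′ Y≐Y′ n = Σ-cong (suc n) (λ i → *-cong (X≐X′ i) (Y≐Y′ (n ∸ i)))

  ⊛-comm : ∀ X Y → X ⊛ Y ≐ Y ⊛ X
  ⊛-comm X Y n = trans (Σ-reverse n _) (Σ-congᵇ (suc n) λ { i (s≤s i≤n) →
    trans (*-comm _ _) (*-congʳ (reflexive (≡.cong Y (ℕₚ.m∸[m∸n]≡n i≤n)))) })

  ⊛-identityˡ : ∀ X → one ⊛ X ≐ X
  ⊛-identityˡ X n = begin
    Σ< (suc n) (λ i → one i * X (n ∸ i))        ≈⟨ Σ-front n _ ⟩
    1# * X n + Σ< n (λ i → 0# * X (n ∸ suc i))  ≈⟨ +-cong (*-identityˡ _) (Σ-zero n (λ _ → zeroˡ _)) ⟩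
    X n + 0#                                    ≈⟨ +-identityʳ _ ⟩
    X n                                         ∎
    where open ≈-Reasoning

  shift-⊛ : ∀ m X Y → shift m X ⊛ Y ≐ shift m (X ⊛ Y)
  shift-⊛ zero    X Y n       = refl
  shift-⊛ (suc m) X Y zero    = trans (+-identityˡ _) (zeroˡ _)
  shift-⊛ (suc m) X Y (suc n) = begin
    Σ< (suc (suc n)) (λ i → shift (suc m) X i * Y (suc n ∸ i)) ≈⟨ Σ-front (suc n) _ ⟩
    0# * Y (suc n) + (shift m X ⊛ Y) n                          ≈⟨ +-cong (zeroˡ _) (shift-⊛ m X Y n) ⟩
    0# + shift m (X ⊛ Y) n                                      ≈⟨ +-identityˡ _ ⟩
    shift m (X ⊛ Y) n                                           ∎
    where open ≈-Reasoning

  scale-⊛ : ∀ a X Y → scale a X ⊛ Y ≐ scale a (X ⊛ Y)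
  scale-⊛ a X Y n = trans (Σ-cong (suc n) (λ _ → *-assoc _ _ _)) (sym (Σ-*ˡ (suc n) a _))

  ⊖-⊛ : ∀ X Y Z → (X ⊖ Y) ⊛ Z ≐ (X ⊛ Z) ⊖ (Y ⊛ Z)
  ⊖-⊛ X Y Z n = trans (Σ-cong (suc n) (λ _ → [y-z]x≈yx-zx _ _ _)) (Σ-distrib-- (suc n) _ _)

  shift-one-diagonal : ∀ m → shift m one m ≈ 1#
  shift-one-diagonal zero    = refl
  shift-one-diagonal (suc m) = shift-one-diagonal m

  shift-one-off : ∀ m n → m ≢ n → shift m one n ≈ 0#
  shift-one-off zero    zero    m≢n = contradiction ≡.refl m≢n
  shift-one-off zero    (suc n) m≢n = refl
  shift-one-off (suc m) zero    m≢n = refl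
  shift-one-off (suc m) (suc n) m≢n = shift-one-off m n (m≢n ∘ ≡.cong suc)

  qpow≐shift : ∀ m → qpow m ≐ shift m one
  qpow≐shift m n with m ℕ.≟ n
  ... | yes ≡.refl = sym (shift-one-diagonal m)
  ... | no  m≢n    = sym (shift-one-off m n m≢n)

  qpow-^ˢ : ∀ m k → qpow m ^ˢ k ≐ shift (k ℕ.* m) one
  qpow-^ˢ m zero    = λ _ → refl
  qpow-^ˢ m (suc k) = begin
    (qpow m ^ˢ k) ⊛ qpow m              ≈⟨ ⊛-cong (qpow-^ˢ m k) (qpow≐shift m) ⟩
    shift (k ℕ.* m) one ⊛ shift m one   ≈⟨ shift-⊛ (k ℕ.* m) one (shift m one) ⟩
    shift (k ℕ.* m) (one ⊛ shift m one) ≈⟨ shift-cong (k ℕ.* m) (⊛-identityˡ (shift m one)) ⟩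
    shift (k ℕ.* m) (shift m one)       ≈⟨ shift-+ (k ℕ.* m) m one ⟩
    shift (k ℕ.* m ℕ.+ m) one           ≡⟨ ≡.cong (λ e → shift e one) (ℕₚ.+-comm (k ℕ.* m) m) ⟩
    shift (suc k ℕ.* m) one             ∎
    where open ≐-Reasoning

  invRev-Σ : ∀ P n (g : ℕ → Carrier) →
    foldr _+_ 0# (zipWith _*_ (applyUpTo g (suc n)) (invRev P n)) ≈ Σ< (suc n) (λ i → g i * inv P (n ∸ i))
  invRev-Σ P zero    g = trans (+-identityʳ _) (sym (+-identityˡ _))
  invRev-Σ P (suc n) g = trans (+-congˡ (invRev-Σ P n (g ∘ suc))) (sym (Σ-front (suc n) _))

  ⊛-inverseʳ : ∀ P → P 0 ≈ 1# → P ⊛ inv P ≐ one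
  ⊛-inverseʳ P P₀≈1 zero    = trans (+-identityˡ _) (trans (*-identityʳ _) P₀≈1)
  ⊛-inverseʳ P P₀≈1 (suc n) = begin
    Σ< (suc (suc n)) (λ i → P i * inv P (suc n ∸ i)) ≈⟨ Σ-front (suc n) _ ⟩
    P 0 * inv P (suc n) + S                          ≈⟨ +-congʳ (*-cong P₀≈1 (-‿cong (invRev-Σ P n (P ∘ suc)))) ⟩
    1# * - S + S                                     ≈⟨ +-congʳ (*-identityˡ _) ⟩
    - S + S                                          ≈⟨ -‿inverseˡ S ⟩
    0#                                               ∎
    where
    open ≈-Reasoning
    S = Σ< (suc n) (λ i → P (suc i) * inv P (n ∸ i))

  ⊛-cancelʳ : ∀ P {X Y} → P 0 ≈ 1# → X ⊛ P ≐ Y ⊛ P → X ≐ Y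
  ⊛-cancelʳ P {X} {Y} P₀≈1 XP≐YP = <-rec (λ n → X n ≈ Y n) step
    where
    step : ∀ n → (∀ {m} → m < n → X m ≈ Y m) → X n ≈ Y n
    step n ih = begin
      X n             ≈⟨ *-identityʳ (X n) ⟨
      X n * 1#        ≈⟨ *-congˡ Pₙₙ≈1 ⟨
      X n * P (n ∸ n) ≈⟨ +-cancelˡ (Σ< n (λ i → Y i * P (n ∸ i))) _ _
                           (trans (+-congʳ (sym (Σ-congᵇ n (λ i i<n → *-congʳ (ih i<n))))) (XP≐YP n)) ⟩
      Y n * P (n ∸ n) ≈⟨ *-congˡ Pₙₙ≈1 ⟩
      Y n * 1#        ≈⟨ *-identityʳ (Y n) ⟩
      Y n             ∎
      where
      open ≈-Reasoning
      Pₙₙ≈1 : P (n ∸ n) ≈ 1#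
      Pₙₙ≈1 = trans (reflexive (≡.cong P (ℕₚ.n∸n≡0 n))) P₀≈1

  inv-unique : ∀ P {X} → P 0 ≈ 1# → P ⊛ X ≐ one → X ≐ inv P
  inv-unique P {X} P₀≈1 PX≐1 = ⊛-cancelʳ P P₀≈1 (begin
    X ⊛ P      ≈⟨ ⊛-comm X P ⟩
    P ⊛ X      ≈⟨ PX≐1 ⟩
    one        ≈⟨ ⊛-inverseʳ P P₀≈1 ⟨
    P ⊛ inv P  ≈⟨ ⊛-comm P (inv P) ⟩
    inv P ⊛ P  ∎)
    where open ≐-Reasoning

module QPochhammer {c ℓ : Level} (A : CommutativeRing c ℓ)
                   (s : ℕ) .{{_ : NonZero s}} (C : CommutativeRing.Carrier A) where
  open CommutativeRing A
  open Series A
  open FormalPowerSeries A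
  open import Algebra.Properties.Ring ring using (-0#≈0#)
  open ≐-Reasoning

  Q : PS
  Q = qpow s

  [1-Cq^_]·_ : ℕ → PS → PS
  [1-Cq^ m ]· X = X ⊖ scale C (shift m X)

  [1-Cq^]-cong : ∀ m {X Y} → X ≐ Y → [1-Cq^ m ]· X ≐ [1-Cq^ m ]· Y
  [1-Cq^]-cong m X≐Y n = +-cong (X≐Y n) (-‿cong (*-congˡ (shift-cong m X≐Y n)))

  [1-Cq^]-⊛ : ∀ m X Y → ([1-Cq^ m ]· X) ⊛ Y ≐ [1-Cq^ m ]· (X ⊛ Y)
  [1-Cq^]-⊛ m X Y n = trans (⊖-⊛ X (scale C (shift m X)) Y n)
    (+-congˡ (-‿cong (trans (scale-⊛ C (shift m X) Y n) (*-congˡ (shift-⊛ m X Y n)))))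

  [1-Cq^]-constantTerm : ∀ {m} X → 0 < m → ([1-Cq^ m ]· X) 0 ≈ X 0
  [1-Cq^]-constantTerm X 0<m =
    trans (+-congˡ (trans (-‿cong (trans (*-congˡ (shift-below X 0<m)) (zeroʳ C))) -0#≈0#)) (+-identityʳ _)

  poch-factor : ∀ i X → X ⊛ (one ⊖ (scale C Q ⊛ (Q ^ˢ i))) ≐ [1-Cq^ suc i ℕ.* s ]· X
  poch-factor i X = begin
    X ⊛ (one ⊖ (scale C Q ⊛ (Q ^ˢ i)))              ≈⟨ ⊛-cong ≐-refl factor≐ ⟩
    X ⊛ ([1-Cq^ suc i ℕ.* s ]· one)                  ≈⟨ ⊛-comm X _ ⟩
    ([1-Cq^ suc i ℕ.* s ]· one) ⊛ X                  ≈⟨ [1-Cq^]-⊛ (suc i ℕ.* s) one X ⟩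
    [1-Cq^ suc i ℕ.* s ]· (one ⊛ X)                  ≈⟨ [1-Cq^]-cong (suc i ℕ.* s) (⊛-identityˡ X) ⟩
    [1-Cq^ suc i ℕ.* s ]· X                          ∎
    where
    factor≐ : one ⊖ (scale C Q ⊛ (Q ^ˢ i)) ≐ [1-Cq^ suc i ℕ.* s ]· one
    factor≐ n = +-congˡ (-‿cong (trans (scale-⊛ C Q (Q ^ˢ i) n)
                  (*-congˡ (trans (⊛-comm Q (Q ^ˢ i) n) (qpow-^ˢ s (suc i) n)))))

  poch-constantTerm : ∀ k → poch (scale C Q) Q k 0 ≈ 1#
  poch-constantTerm zero    = refl
  poch-constantTerm (suc k) = trans (poch-factor k (poch (scale C Q) Q k) 0)
    (trans ([1-Cq^]-constantTerm (poch (scale C Q) Q k) (0<[1+k]*s k s))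
           (poch-constantTerm k))

  module _ (F : ℕ → PS) (F₀≐1 : F 0 ≐ one) (F-rec : ∀ k → [1-Cq^ suc k ℕ.* s ]· F (suc k) ≐ F k) where

    poch⊛F≐one : ∀ k → poch (scale C Q) Q k ⊛ F k ≐ one
    poch⊛F≐one zero    = ≐-trans (⊛-identityˡ (F 0)) F₀≐1
    poch⊛F≐one (suc k) = begin
      (P ⊛ (one ⊖ (scale C Q ⊛ (Q ^ˢ k)))) ⊛ F (suc k) ≈⟨ ⊛-cong (poch-factor k P) (≐-refl {F (suc k)}) ⟩
      ([1-Cq^ M ]· P) ⊛ F (suc k)                     ≈⟨ [1-Cq^]-⊛ M P (F (suc k)) ⟩
      [1-Cq^ M ]· (P ⊛ F (suc k))                     ≈⟨ [1-Cq^]-cong M (⊛-comm P (F (suc k))) ⟩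
      [1-Cq^ M ]· (F (suc k) ⊛ P)                     ≈⟨ [1-Cq^]-⊛ M (F (suc k)) P ⟨
      ([1-Cq^ M ]· F (suc k)) ⊛ P                     ≈⟨ ⊛-cong (F-rec k) (≐-refl {P}) ⟩
      F k ⊛ P                                         ≈⟨ ⊛-comm (F k) P ⟩
      P ⊛ F k                                         ≈⟨ poch⊛F≐one k ⟩
      one                                             ∎
      where
      P = poch (scale C Q) Q k
      M = suc k ℕ.* s

    inv-poch : ∀ k → inv (poch (scale C Q) Q k) ≐ F k
    inv-poch k = ≐-sym (inv-unique (poch (scale C Q) Q k) (poch-constantTerm k) (poch⊛F≐one k))

    poch-term : ∀ k → scale C (Q ^ˢ k) ⊘ poch (scale C Q) Q k ≐ scale C (shift (k ℕ.* s) (F k))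
    poch-term k = begin
      scale C (Q ^ˢ k) ⊛ inv P                ≈⟨ scale-⊛ C (Q ^ˢ k) (inv P) ⟩
      scale C ((Q ^ˢ k) ⊛ inv P)              ≈⟨ scale-cong (⊛-cong (qpow-^ˢ s k) (inv-poch k)) ⟩
      scale C (shift (k ℕ.* s) one ⊛ F k)     ≈⟨ scale-cong (shift-⊛ (k ℕ.* s) one (F k)) ⟩
      scale C (shift (k ℕ.* s) (one ⊛ F k))   ≈⟨ scale-cong (shift-cong (k ℕ.* s) (⊛-identityˡ (F k))) ⟩
      scale C (shift (k ℕ.* s) (F k))         ∎
      where
      P = poch (scale C Q) Q k
      scale-cong : ∀ {X Y} → X ≐ Y → scale C X ≐ scale C Y
      scale-cong X≐Y n = *-congˡ (X≐Y n)

module PartitionGF {c ℓ : Level} (A : CommutativeRing c ℓ) (s : ℕ) .{{_ : NonZero s}} where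
  open CommutativeRing A
  open Series A
  open FiniteSums A
  open FormalPowerSeries A
  open PartitionCombinatorics using (largestPart)
  open import Algebra.Properties.CommutativeSemigroup *-commutativeSemigroup using (xy∙z≈y∙xz; interchange)
  open import Algebra.Properties.CommutativeSemigroup ℕₚ.+-commutativeSemigroup
    using () renaming (xy∙z≈xz∙y to +-xy∙z≈xz∙y)
  open ≈-Reasoning

  -- exactPartsGF Y k M = Σ Y^μ₁ q^(s·|μ|) over the partitions μ with exactly k parts, all ≤ M,
  -- by recursion on the largest part μ₁ = a + 1.
  exactPartsGF : Carrier → ℕ → ℕ → PS
  exactPartsGF Y zero    M = one
  exactPartsGF Y (suc k) M =
    Σˢ M (λ a → scale (pow Y (suc a)) (shift (suc a ℕ.* s) (exactPartsGF 1# k (suc a))))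

  atMostPartsGF : Carrier → ℕ → ℕ → PS
  atMostPartsGF Y k M = Σˢ (suc k) (λ i → exactPartsGF Y i M)

  atMostPartsGF-0 : ∀ Y k → atMostPartsGF Y k 0 ≐ one
  atMostPartsGF-0 Y k n = trans (Σ-front k _) (trans (+-congˡ (Σ-zero k (λ _ → refl))) (+-identityʳ _))

  atMostPartsGF-byLargestPart : ∀ Y k M →
    atMostPartsGF Y (suc k) M ≐ Σˢ (suc M) (λ a → scale (pow Y a) (shift (a ℕ.* s) (atMostPartsGF 1# k a)))
  atMostPartsGF-byLargestPart Y k M n = begin
    Σ< (suc (suc k)) (λ i → exactPartsGF Y i M n)
      ≈⟨ Σ-front (suc k) _ ⟩
    one n + Σ< (suc k) (λ i → Σ< M (λ a → pow Y (suc a) * shift (suc a ℕ.* s) (exactPartsGF 1# i (suc a)) n))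
      ≈⟨ +-congˡ (Σ-swap (suc k) M _) ⟩
    one n + Σ< M (λ a → Σ< (suc k) (λ i → pow Y (suc a) * shift (suc a ℕ.* s) (exactPartsGF 1# i (suc a)) n))
      ≈⟨ +-congˡ (Σ-cong M (λ a → trans (*-congˡ (shift-Σˢ (suc a ℕ.* s) (suc k) _ n)) (Σ-*ˡ (suc k) _ _))) ⟨
    one n + Σ< M (λ a → pow Y (suc a) * shift (suc a ℕ.* s) (atMostPartsGF 1# k (suc a)) n)
      ≈⟨ +-congʳ (trans (*-identityˡ _) (atMostPartsGF-0 1# k n)) ⟨
    1# * atMostPartsGF 1# k 0 n + Σ< M (λ a → pow Y (suc a) * shift (suc a ℕ.* s) (atMostPartsGF 1# k (suc a)) n)
      ≈⟨ Σ-front M _ ⟨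
    Σ< (suc M) (λ a → pow Y a * shift (a ℕ.* s) (atMostPartsGF 1# k a) n)
      ∎

  private
    peelFirstColumn : ∀ k → (∀ a → exactPartsGF 1# k (suc a) ≐ shift (k ℕ.* s) (atMostPartsGF 1# k a)) →
      ∀ Y M → exactPartsGF Y (suc k) (suc M) ≐ scale Y (shift (suc k ℕ.* s) (atMostPartsGF Y (suc k) M))
    peelFirstColumn k removeColumn Y M n = begin
      Σ< (suc M) (λ a → pow Y (suc a) * shift (suc a ℕ.* s) (exactPartsGF 1# k (suc a)) n)
        ≈⟨ Σ-cong (suc M) (λ a → *-congˡ (shift-cong (suc a ℕ.* s) (removeColumn a) n)) ⟩
      Σ< (suc M) (λ a → pow Y (suc a) * shift (suc a ℕ.* s) (shift (k ℕ.* s) (X a)) n)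
        ≈⟨ Σ-cong (suc M) reorder ⟩
      Σ< (suc M) (λ a → Y * shift (suc k ℕ.* s) (scale (pow Y a) (shift (a ℕ.* s) (X a))) n)
        ≈⟨ Σ-*ˡ (suc M) Y _ ⟨
      Y * Σ< (suc M) (λ a → shift (suc k ℕ.* s) (scale (pow Y a) (shift (a ℕ.* s) (X a))) n)
        ≈⟨ *-congˡ (shift-Σˢ (suc k ℕ.* s) (suc M) _ n) ⟨
      Y * shift (suc k ℕ.* s) (Σˢ (suc M) (λ a → scale (pow Y a) (shift (a ℕ.* s) (X a)))) n
        ≈⟨ *-congˡ (shift-cong (suc k ℕ.* s) (atMostPartsGF-byLargestPart Y k M) n) ⟨
      Y * shift (suc k ℕ.* s) (atMostPartsGF Y (suc k) M) n
        ∎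
      where
      X : ℕ → PS
      X = atMostPartsGF 1# k
      reorder : ∀ a → pow Y (suc a) * shift (suc a ℕ.* s) (shift (k ℕ.* s) (X a)) n
                    ≈ Y * shift (suc k ℕ.* s) (scale (pow Y a) (shift (a ℕ.* s) (X a))) n
      reorder a = begin
        pow Y a * Y * shift (suc a ℕ.* s) (shift (k ℕ.* s) (X a)) n
          ≈⟨ *-congˡ (shift-+ (suc a ℕ.* s) (k ℕ.* s) (X a) n) ⟩
        pow Y a * Y * shift (suc a ℕ.* s ℕ.+ k ℕ.* s) (X a) n
          ≡⟨ ≡.cong (λ m → pow Y a * Y * shift m (X a) n) (+-xy∙z≈xz∙y s (a ℕ.* s) (k ℕ.* s)) ⟩
        pow Y a * Y * shift (suc k ℕ.* s ℕ.+ a ℕ.* s) (X a) n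
          ≈⟨ xy∙z≈y∙xz _ _ _ ⟩
        Y * (pow Y a * shift (suc k ℕ.* s ℕ.+ a ℕ.* s) (X a) n)
          ≈⟨ *-congˡ (*-congˡ (shift-+ (suc k ℕ.* s) (a ℕ.* s) (X a) n)) ⟨
        Y * (pow Y a * shift (suc k ℕ.* s) (shift (a ℕ.* s) (X a)) n)
          ≈⟨ *-congˡ (shift-scale (suc k ℕ.* s) (pow Y a) (shift (a ℕ.* s) (X a)) n) ⟨
        Y * shift (suc k ℕ.* s) (scale (pow Y a) (shift (a ℕ.* s) (X a))) n
          ∎

  removeFirstColumn-1# : ∀ k a → exactPartsGF 1# k (suc a) ≐ shift (k ℕ.* s) (atMostPartsGF 1# k a)
  removeFirstColumn-1# zero    a n = sym (+-identityˡ _)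
  removeFirstColumn-1# (suc k) a n = trans (peelFirstColumn k (removeFirstColumn-1# k) 1# a n) (*-identityˡ _)

  removeFirstColumn : ∀ Y k M →
    exactPartsGF Y (suc k) (suc M) ≐ scale Y (shift (suc k ℕ.* s) (atMostPartsGF Y (suc k) M))
  removeFirstColumn Y k = peelFirstColumn k (removeFirstColumn-1# k) Y

  exactPartsGF-bound : ∀ Y k {M n} → n ≤ M → exactPartsGF Y k M n ≈ exactPartsGF Y k n n
  exactPartsGF-bound Y zero              n≤M = refl
  exactPartsGF-bound Y (suc k) {M} {n} n≤M = begin
    Σ< M f                                    ≡⟨ ≡.cong (λ m → Σ< m f) (ℕₚ.m+[n∸m]≡n n≤M) ⟨
    Σ< (n ℕ.+ (M ∸ n)) f                      ≈⟨ Σ-split n (M ∸ n) f ⟩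
    Σ< n f + Σ< (M ∸ n) (λ j → f (n ℕ.+ j))   ≈⟨ +-congˡ (Σ-zero (M ∸ n) vanishes) ⟩
    Σ< n f + 0#                               ≈⟨ +-identityʳ _ ⟩
    Σ< n f                                    ∎
    where
    f : ℕ → Carrier
    f a = pow Y (suc a) * shift (suc a ℕ.* s) (exactPartsGF 1# k (suc a)) n
    vanishes : ∀ j → f (n ℕ.+ j) ≈ 0#
    vanishes j = trans (*-congˡ (shift-below _ (ℕₚ.<-≤-trans (s≤s (ℕₚ.m≤m+n n j)) (ℕₚ.m≤m*n (suc (n ℕ.+ j)) s))))
                       (zeroʳ _)

  atMostPartsGF-bound : ∀ Y k {M n} → n ≤ M → atMostPartsGF Y k M n ≈ atMostPartsGF Y k n n
  atMostPartsGF-bound Y k n≤M = Σ-cong (suc k) (λ i → exactPartsGF-bound Y i n≤M)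

  -- The coefficient of q^n only involves parts μᵢ with s·μᵢ ≤ n, so the bound M = n loses nothing.
  exactPartsGF∞ : Carrier → ℕ → PS
  exactPartsGF∞ Y k n = exactPartsGF Y k n n

  atMostPartsGF∞ : Carrier → ℕ → PS
  atMostPartsGF∞ Y k n = atMostPartsGF Y k n n

  removeFirstColumn∞ : ∀ Y k → exactPartsGF∞ Y (suc k) ≐ scale Y (shift (suc k ℕ.* s) (atMostPartsGF∞ Y (suc k)))
  removeFirstColumn∞ Y k zero    = sym (trans (*-congˡ (shift-below _ (0<[1+k]*s k s))) (zeroʳ Y))
  removeFirstColumn∞ Y k (suc n) = trans (removeFirstColumn Y k n (suc n))
    (*-congˡ (shift-congᵇ (suc k ℕ.* s) (suc n) (λ j j+M≤1+n →
      atMostPartsGF-bound Y (suc k) (s≤s⁻¹ (ℕₚ.<-≤-trans (ℕₚ.m<m+n j (0<[1+k]*s k s)) j+M≤1+n)))))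

  partitionGF : ℕ → Carrier → Carrier → ℕ → PS
  partitionGF K X Y M = Σˢ (suc K) (λ k → scale (pow X k) (exactPartsGF Y k M))

  partitionGF-constantTerm : ∀ K X Y M → partitionGF K X Y M 0 ≈ 1#
  partitionGF-constantTerm K X Y M = begin
    Σ< (suc K) (λ k → pow X k * exactPartsGF Y k M 0)
      ≈⟨ Σ-front K _ ⟩
    1# * 1# + Σ< K (λ k → pow X (suc k) * exactPartsGF Y (suc k) M 0)
      ≈⟨ +-cong (*-identityˡ 1#) (Σ-zero K (λ k → trans (*-congˡ (Σ-zero M (λ a →
           trans (*-congˡ (shift-below _ (0<[1+k]*s a s))) (zeroʳ _)))) (zeroʳ _))) ⟩
    1# + 0#
      ≈⟨ +-identityʳ 1# ⟩
    1# ∎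

  partitionGF-byLargestPart : ∀ K X Y M →
    partitionGF (suc K) X Y M ≐ one ⊕ Σˢ M (λ a → shift (suc a ℕ.* s) (scale (X * pow Y (suc a)) (partitionGF K X 1# (suc a))))
  partitionGF-byLargestPart K X Y M n = begin
    Σ< (suc (suc K)) (λ k → pow X k * exactPartsGF Y k M n)
      ≈⟨ Σ-front (suc K) _ ⟩
    1# * one n + Σ< (suc K) (λ k → pow X (suc k) * Σ< M (λ a → pow Y (suc a) * S k a))
      ≈⟨ +-cong (*-identityˡ _) (Σ-cong (suc K) (λ k → Σ-*ˡ M (pow X (suc k)) _)) ⟩
    one n + Σ< (suc K) (λ k → Σ< M (λ a → pow X (suc k) * (pow Y (suc a) * S k a)))
      ≈⟨ +-congˡ (Σ-swap (suc K) M _) ⟩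
    one n + Σ< M (λ a → Σ< (suc K) (λ k → pow X (suc k) * (pow Y (suc a) * S k a)))
      ≈⟨ +-congˡ (Σ-cong M (λ a → trans (Σ-cong (suc K) (λ k → regroup (pow X k) (pow Y (suc a)) (S k a)))
                                         (sym (Σ-*ˡ (suc K) (X * pow Y (suc a)) _)))) ⟩
    one n + Σ< M (λ a → (X * pow Y (suc a)) * Σ< (suc K) (λ k → pow X k * S k a))
      ≈⟨ +-congˡ (Σ-cong M (λ a → sym (shifted a))) ⟩
    one n + Σ< M (λ a → shift (suc a ℕ.* s) (scale (X * pow Y (suc a)) (partitionGF K X 1# (suc a))) n)
      ∎
    where
    S : ℕ → ℕ → Carrier
    S k a = shift (suc a ℕ.* s) (exactPartsGF 1# k (suc a)) n
    regroup : ∀ xᵏ y t → xᵏ * X * (y * t) ≈ (X * y) * (xᵏ * t)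
    regroup xᵏ y t = trans (*-congʳ (*-comm xᵏ X)) (interchange X xᵏ y t)
    shifted : ∀ a → shift (suc a ℕ.* s) (scale (X * pow Y (suc a)) (partitionGF K X 1# (suc a))) n
                    ≈ (X * pow Y (suc a)) * Σ< (suc K) (λ k → pow X k * S k a)
    shifted a = trans (shift-scale (suc a ℕ.* s) _ _ n) (*-congˡ (trans (shift-Σˢ (suc a ℕ.* s) (suc K) _ n)
                  (Σ-cong (suc K) (λ k → shift-scale (suc a ℕ.* s) (pow X k) (exactPartsGF 1# k (suc a)) n))))

  pow-1# : ∀ k → pow 1# k ≈ 1#
  pow-1# zero    = refl
  pow-1# (suc k) = trans (*-identityʳ _) (pow-1# k)

  weight : Carrier → Carrier → List ℕ → Carrier
  weight X Y λ′ = when (all? (s ∣?_) λ′) (pow X (length λ′) * pow Y (largestPart λ′ / s))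

  weight-[] : ∀ X Y → weight X Y [] ≈ 1#
  weight-[] X Y = trans (*-identityˡ _) (reflexive (≡.cong (pow Y) (0/n≡0 s)))

  weight-∷ : ∀ X Y q μ → weight X Y (q ∷ μ) ≈ when (s ∣? q) (X * pow Y (q / s)) * weight X 1# μ
  weight-∷ X Y q μ = split (s ∣? q) (all? (s ∣?_) μ)
    where
    split : ∀ {p r} {P : Set p} {R : Set r} (d : Dec P) (e : Dec R) →
      (if does d ∧ does e then pow X (length μ) * X * pow Y (q / s) else 0#)
        ≈ when d (X * pow Y (q / s)) * when e (pow X (length μ) * pow 1# (largestPart μ / s))
    split (yes _) (yes _) = begin
      pow X (length μ) * X * pow Y (q / s)                       ≈⟨ xy∙z≈y∙xz _ _ _ ⟩
      X * (pow X (length μ) * pow Y (q / s))                     ≈⟨ *-congˡ (*-comm _ _) ⟩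
      X * (pow Y (q / s) * pow X (length μ))                     ≈⟨ *-assoc _ _ _ ⟨
      X * pow Y (q / s) * pow X (length μ)                       ≈⟨ *-congˡ (*-identityʳ _) ⟨
      X * pow Y (q / s) * (pow X (length μ) * 1#)                ≈⟨ *-congˡ (*-congˡ (pow-1# (largestPart μ / s))) ⟨
      X * pow Y (q / s) * (pow X (length μ) * pow 1# (largestPart μ / s)) ∎
    split (yes _) (no _)  = sym (zeroʳ _)
    split (no _)  _       = sym (zeroˡ _)

  weightSum : Carrier → Carrier → ℕ → ℕ → ℕ → Carrier
  weightSum X Y f n m = sumL (weight X Y) (partsF f n m)

  sumL-weight-∷ : ∀ X Y q μs →
    sumL (weight X Y) (map (q ∷_) μs) ≈ when (s ∣? q) (X * pow Y (q / s) * sumL (weight X 1#) μs)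
  sumL-weight-∷ X Y q μs = begin
    sumL (weight X Y) (map (q ∷_) μs)                                   ≡⟨ sumL-map (weight X Y) (q ∷_) μs ⟩
    sumL (λ μ → weight X Y (q ∷ μ)) μs                                  ≈⟨ sumL-cong (weight-∷ X Y q) μs ⟩
    sumL (λ μ → when (s ∣? q) (X * pow Y (q / s)) * weight X 1# μ) μs  ≈⟨ sumL-*ˡ _ (weight X 1#) μs ⟨
    when (s ∣? q) (X * pow Y (q / s)) * sumL (weight X 1#) μs          ≈⟨ when-*ʳ (s ∣? q) _ _ ⟩
    when (s ∣? q) (X * pow Y (q / s) * sumL (weight X 1#) μs)          ∎

  weightSum-byFirstPart : ∀ X Y f n m → weightSum X Y (suc f) (suc n) m ≈
    Σ< (suc n) (λ p → when (suc p ≤? m) (when (s ∣? suc p) (X * pow Y (suc p / s) * weightSum X 1# f (n ∸ p) (suc p))))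
  weightSum-byFirstPart X Y f n m = begin
    sumL (weight X Y) (concatMap h (filter (λ p → suc p ≤? m) (upTo (suc n))))
      ≈⟨ sumL-concatMap (weight X Y) h (filter (λ p → suc p ≤? m) (upTo (suc n))) ⟩
    sumL (sumL (weight X Y) ∘ h) (filter (λ p → suc p ≤? m) (upTo (suc n)))
      ≈⟨ sumL-filter (λ p → suc p ≤? m) _ (upTo (suc n)) ⟩
    sumL (λ p → when (suc p ≤? m) (sumL (weight X Y) (h p))) (upTo (suc n))
      ≈⟨ sumL-applyUpTo _ id (suc n) ⟩
    Σ< (suc n) (λ p → when (suc p ≤? m) (sumL (weight X Y) (h p)))
      ≈⟨ Σ-cong (suc n) (λ p → when-cong (suc p ≤? m) (λ _ → sumL-weight-∷ X Y (suc p) (partsF f (n ∸ p) (suc p)))) ⟩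
    Σ< (suc n) (λ p → when (suc p ≤? m) (when (s ∣? suc p) (X * pow Y (suc p / s) * weightSum X 1# f (n ∸ p) (suc p))))
      ∎
    where
    h : ℕ → List (List ℕ)
    h p = map (suc p ∷_) (partsF f (n ∸ p) (suc p))

  Σ-lastBlock : ∀ b (g : ℕ → Carrier) → s ∣ b →
    Σ< s (λ j → when (s ∣? suc (b ℕ.+ j)) (g (suc (b ℕ.+ j)))) ≈ g (b ℕ.+ s)
  Σ-lastBlock b g s∣b = begin
    Σ< s G
      ≈⟨ Σ-last s G ⟩
    Σ< (ℕ.pred s) G + G (ℕ.pred s)
      ≈⟨ +-cong (trans (Σ-congᵇ (ℕ.pred s) (λ j j<p → when-no (s ∣? _) (notMultiple j<p)))
                       (Σ-zero (ℕ.pred s) (λ _ → refl)))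
                lastTerm ⟩
    0# + g (b ℕ.+ s)
      ≈⟨ +-identityˡ _ ⟩
    g (b ℕ.+ s)
      ∎
    where
    G : ℕ → Carrier
    G j = when (s ∣? suc (b ℕ.+ j)) (g (suc (b ℕ.+ j)))
    notMultiple : ∀ {j} → j < ℕ.pred s → ¬ s ∣ suc (b ℕ.+ j)
    notMultiple {j} j<p s∣ = ℕₚ.<⇒≱ (ℕₚ.<-≤-trans (s≤s j<p) (ℕₚ.≤-reflexive (ℕₚ.suc-pred s)))
      (∣⇒≤ (∣m+n∣m⇒∣n (≡.subst (s ∣_) (≡.sym (ℕₚ.+-suc b j)) s∣) s∣b))
    lastTerm : G (ℕ.pred s) ≈ g (b ℕ.+ s)
    lastTerm = ≡.subst (λ m → when (s ∣? m) (g m) ≈ g (b ℕ.+ s)) (≡.sym lastIndex)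
                 (when-yes (s ∣? b ℕ.+ s) (∣m∣n⇒∣m+n s∣b ∣-refl))
      where
      lastIndex : suc (b ℕ.+ ℕ.pred s) ≡ b ℕ.+ s
      lastIndex = ≡.trans (≡.sym (ℕₚ.+-suc b (ℕ.pred s))) (≡.cong (b ℕ.+_) (ℕₚ.suc-pred s))

  Σ-multiples : ∀ M (g : ℕ → Carrier) →
    Σ< (M ℕ.* s) (λ p → when (s ∣? suc p) (g (suc p))) ≈ Σ< M (λ a → g (suc a ℕ.* s))
  Σ-multiples zero    g = refl
  Σ-multiples (suc M) g = begin
    Σ< (s ℕ.+ M ℕ.* s) F                                ≡⟨ ≡.cong (λ m → Σ< m F) (ℕₚ.+-comm s (M ℕ.* s)) ⟩
    Σ< (M ℕ.* s ℕ.+ s) F                                ≈⟨ Σ-split (M ℕ.* s) s F ⟩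
    Σ< (M ℕ.* s) F + Σ< s (λ j → F (M ℕ.* s ℕ.+ j))     ≈⟨ +-cong (Σ-multiples M g) (Σ-lastBlock (M ℕ.* s) g (n∣m*n M)) ⟩
    Σ< M (λ a → g (suc a ℕ.* s)) + g (M ℕ.* s ℕ.+ s)    ≡⟨ ≡.cong (λ m → Σ< M (λ a → g (suc a ℕ.* s)) + g m)
                                                                   (ℕₚ.+-comm (M ℕ.* s) s) ⟩
    Σ< (suc M) (λ a → g (suc a ℕ.* s))                  ∎
    where
    F : ℕ → Carrier
    F p = when (s ∣? suc p) (g (suc p))

  Σ-boundedMultiples : ∀ N M (g : ℕ → Carrier) →
    Σ< N (λ p → when (suc p ≤? M ℕ.* s) (when (s ∣? suc p) (g (suc p))))
      ≈ Σ< M (λ a → when (suc a ℕ.* s ≤? N) (g (suc a ℕ.* s)))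
  Σ-boundedMultiples N M g = begin
    Σ< N (λ p → when (suc p ≤? M ℕ.* s) (when (s ∣? suc p) (g (suc p))))
      ≈⟨ Σ-when-<-swap N (M ℕ.* s) _ ⟩
    Σ< (M ℕ.* s) (λ p → when (suc p ≤? N) (when (s ∣? suc p) (g (suc p))))
      ≈⟨ Σ-cong (M ℕ.* s) (λ p → when-comm (suc p ≤? N) (s ∣? suc p) _) ⟩
    Σ< (M ℕ.* s) (λ p → when (s ∣? suc p) (when (suc p ≤? N) (g (suc p))))
      ≈⟨ Σ-multiples M (λ q → when (q ≤? N) (g q)) ⟩
    Σ< M (λ a → when (suc a ℕ.* s ≤? N) (g (suc a ℕ.* s)))
      ∎

  weightSum≈partitionGF : ∀ f n M K X Y → n ≤ f → n ≤ K → weightSum X Y f n (M ℕ.* s) ≈ partitionGF K X Y M n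
  weightSum≈partitionGF f       zero    M K X Y _ _ =
    trans (+-identityʳ _) (trans (weight-[] X Y) (sym (partitionGF-constantTerm K X Y M)))
  weightSum≈partitionGF (suc f) (suc n) M (suc K) X Y (s≤s n≤f) (s≤s n≤K) = begin
    weightSum X Y (suc f) (suc n) (M ℕ.* s)
      ≈⟨ weightSum-byFirstPart X Y f n (M ℕ.* s) ⟩
    Σ< (suc n) (λ p → when (suc p ≤? M ℕ.* s) (when (s ∣? suc p) (g (suc p))))
      ≈⟨ Σ-boundedMultiples (suc n) M g ⟩
    Σ< M (λ a → when (suc a ℕ.* s ≤? suc n) (g (suc a ℕ.* s)))
      ≈⟨ Σ-cong M (λ a → trans (when-cong (suc a ℕ.* s ≤? suc n) (λ _ → *-congʳ (*-congˡ (pow-/s a))))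
                                (sym (shift-when (suc a ℕ.* s) (suc n) (G a)))) ⟩
    Σ< M (λ a → shift (suc a ℕ.* s) (G a) (suc n))
      ≈⟨ Σ-cong M (λ a → shift-congᵇ (suc a ℕ.* s) (suc n) (λ j j+c≤1+n → *-congˡ
           (weightSum≈partitionGF f j (suc a) K X 1# (ℕₚ.≤-trans (below a j+c≤1+n) n≤f)
                                                        (ℕₚ.≤-trans (below a j+c≤1+n) n≤K)))) ⟩
    Σ< M (λ a → shift (suc a ℕ.* s) (scale (X * pow Y (suc a)) (partitionGF K X 1# (suc a))) (suc n))
      ≈⟨ +-identityˡ _ ⟨
    (one ⊕ Σˢ M (λ a → shift (suc a ℕ.* s) (scale (X * pow Y (suc a)) (partitionGF K X 1# (suc a))))) (suc n)
      ≈⟨ partitionGF-byLargestPart K X Y M (suc n) ⟨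
    partitionGF (suc K) X Y M (suc n)
      ∎
    where
    g : ℕ → Carrier
    g q = X * pow Y (q / s) * weightSum X 1# f (suc n ∸ q) q
    G : ℕ → PS
    G a r = X * pow Y (suc a) * weightSum X 1# f r (suc a ℕ.* s)
    pow-/s : ∀ a → pow Y (suc a ℕ.* s / s) ≈ pow Y (suc a)
    pow-/s a = reflexive (≡.cong (pow Y) (m*n/n≡m (suc a) s))
    below : ∀ a {j} → j ℕ.+ suc a ℕ.* s ≤ suc n → j ≤ n
    below a j+c≤1+n = s≤s⁻¹ (ℕₚ.<-≤-trans (ℕₚ.m<m+n _ (0<[1+k]*s a s)) j+c≤1+n)

module GeneratingFunctionIdentity {c ℓ : Level} (A : CommutativeRing c ℓ) (s : ℕ) .{{_ : NonZero s}}
                                  (R C : CommutativeRing.Carrier A) where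
  open CommutativeRing A
  open Series A
  open FiniteSums A
  open FormalPowerSeries A
  open PartitionCombinatorics using (largestPart; partsF-bound; partsF-decreasing; cStat-decreasing)
  open PartitionGF A s
  open QPochhammer A s C
  open import Algebra.Properties.Ring ring using (xyx⁻¹≈y)
  open ≈-Reasoning

  atMostPartsGF∞-recurrence : ∀ k → [1-Cq^ suc k ℕ.* s ]· atMostPartsGF∞ C (suc k) ≐ atMostPartsGF∞ C k
  atMostPartsGF∞-recurrence k n = begin
    atMostPartsGF∞ C k n + exactPartsGF∞ C (suc k) n - C * shift (suc k ℕ.* s) (atMostPartsGF∞ C (suc k)) n
      ≈⟨ +-congʳ (+-congˡ (removeFirstColumn∞ C k n)) ⟩
    atMostPartsGF∞ C k n + t - t
      ≈⟨ +-congʳ (+-comm _ _) ⟩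
    t + atMostPartsGF∞ C k n - t
      ≈⟨ xyx⁻¹≈y t _ ⟩
    atMostPartsGF∞ C k n
      ∎
    where t = C * shift (suc k ℕ.* s) (atMostPartsGF∞ C (suc k)) n

  exactPartsGF∞≐term : ∀ k → exactPartsGF∞ C (suc k) ≐ scale C (Q ^ˢ suc k) ⊘ poch (scale C Q) Q (suc k)
  exactPartsGF∞≐term k n = trans (removeFirstColumn∞ C k n)
    (sym (poch-term (atMostPartsGF∞ C) (λ n → +-identityˡ (one n)) atMostPartsGF∞-recurrence (suc k) n))

  lhsGF≈partitionGF : ∀ n → lhsGF s R C n ≈ partitionGF n R C n n
  lhsGF≈partitionGF n = begin
    sumL w (filter (all? (s ∣?_)) (partsF n n n))
      ≈⟨ sumL-filter (all? (s ∣?_)) w (partsF n n n) ⟩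
    sumL (λ λ′ → when (all? (s ∣?_) λ′) (w λ′)) (partsF n n n)
      ≈⟨ sumL-congᴬ (λ decr → when-cong (all? (s ∣?_) _) (statistics decr)) (partsF-decreasing n n n) ⟩
    sumL (weight R C) (partsF n n n)
      ≡⟨ ≡.cong (sumL (weight R C)) (partsF-bound n n (ℕₚ.m≤m*n n s)) ⟨
    weightSum R C n n (n ℕ.* s)
      ≈⟨ weightSum≈partitionGF n n n n R C ℕₚ.≤-refl ℕₚ.≤-refl ⟩
    partitionGF n R C n n
      ∎
    where
    w : List ℕ → Carrier
    w λ′ = pow R (rStat s λ′) * pow C (cStat s λ′)
    statistics : ∀ {λ′} → Linked _≥_ (n ∷ λ′) → All (s ∣_) λ′ →
                 w λ′ ≈ pow R (length λ′) * pow C (largestPart λ′ / s)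
    statistics decr s∣λ′ = reflexive (≡.cong₂ (λ r c → pow R r * pow C c)
      (≡.cong length (List.filter-all (s ∣?_) s∣λ′)) (cStat-decreasing s (Linked.tail decr) s∣λ′))

  partitionGF≈rhsGF : ∀ n → partitionGF n R C n n ≈ rhsGF s R C n
  partitionGF≈rhsGF n = begin
    Σ< (suc n) (λ k → pow R k * exactPartsGF∞ C k n)
      ≈⟨ Σ-front n _ ⟩
    1# * one n + Σ< n (λ k → pow R (suc k) * exactPartsGF∞ C (suc k) n)
      ≈⟨ +-cong (*-identityˡ _) (Σ-cong n (λ k → *-congˡ (exactPartsGF∞≐term k n))) ⟩
    rhsGF s R C n
      ∎

lemma3p2 : {c ℓ : Level} (A : CommutativeRing c ℓ) (s : ℕ) → 0 < s →
    (R C : CommutativeRing.Carrier A) → (n : ℕ) →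
    CommutativeRing._≈_ A (Series.lhsGF A s R C n) (Series.rhsGF A s R C n)
lemma3p2 A s 0<s R C n = CommutativeRing.trans A (lhsGF≈partitionGF n) (partitionGF≈rhsGF n)
  where open GeneratingFunctionIdentity A s {{ℕ.>-nonZero 0<s}} R C
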